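{- Let $\sigma$ be a partition and $a,b,c$ cells of $\sigma$, and let $\beta=1-\alpha$. Then $$\sum_{A,B,C\in\{U,L\}}h^{A}_{\sigma}(a)\,h^{B}_{\sigma}(b)\,h^{C}_{\sigma}(c)\;k^{\bar A\bar B\bar C}=\Big(-\big(h^U_\sigma(a)-h^U_\sigma(b)+h^U_\sigma(c)\big)+k^{UUU}\Big)\beta^3 .$$
   Context: For a cell $x=(j,i)$ of $\sigma$ (French convention, row $i$, column $j$), $h^U_\sigma(x)=\mathrm{leg}_\sigma(x)+(\mathrm{arm}_\sigma(x)+1)\alpha$ and $h^L_\sigma(x)=\mathrm{leg}_\sigma(x)+1+\mathrm{arm}_\sigma(x)\alpha$, so $h^L_\sigma(x)=h^U_\sigma(x)+\beta$. For $A\in\{U,L\}$, $\bar A$ denotes the other element. The constants $k^{ABC}\in\mathbb{Z}[\alpha]$ are: $k^{LLL}=\alpha$, $k^{LLU}=-1$, $k^{LUL}=1-2\alpha$, $k^{LUU}=\alpha$, $k^{UUU}=-1$, $k^{UUL}=\alpha$, $k^{ULU}=2-\alpha$, $k^{ULL}=-1$. -}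

module Defs where

open import Level using (Level)
open import Data.Nat using (ℕ; zero; suc; _≤_; _≥_; _∸_; _≤?_)
open import Data.List using (List; []; _∷_; length; filter)
open import Data.List.Relation.Unary.All using (All)
open import Data.List.Relation.Unary.Linked using (Linked)
open import Algebra.Bundles using (CommutativeRing)

record Partition : Set where
  constructor mkPartition
  field
    parts      : List ℕ
    decreasing : Linked _≥_ parts
    positive   : All (λ p → 1 ≤ p) parts
open Partition public

nth : List ℕ → ℕ → ℕ
nth []       _       = 0
nth (x ∷ xs) zero    = x
nth (x ∷ xs) (suc i) = nth xs i

-- σ_i, rows indexed from 1 (σ_0 := 0, σ_i := 0 for i > ℓ(σ))
row : Partition → ℕ → ℕ
row σ zero    = 0
row σ (suc i) = nth (parts σ) i

-- conjugate partition: σ'_j = #{ i : σ_i ≥ j }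
col : Partition → ℕ → ℕ
col σ j = length (filter (j ≤?_) (parts σ))

-- A cell x = (j , i) of σ (French convention): column j, row i,
-- 1 ≤ i, 1 ≤ j ≤ σ_i.
record Cell (σ : Partition) : Set where
  constructor cell
  field
    j     : ℕ
    i     : ℕ
    1≤i   : 1 ≤ i
    1≤j   : 1 ≤ j
    j≤σᵢ  : j ≤ row σ i
open Cell public

arm : (σ : Partition) → Cell σ → ℕ
arm σ x = row σ (i x) ∸ j x

leg : (σ : Partition) → Cell σ → ℕ
leg σ x = col σ (j x) ∸ i x

data UL : Set where
  U L : UL

bar : UL → UL
bar U = L
bar L = U

-- Everything below lives in ℤ[α]; we state the identity in an arbitrary
-- commutative ring R at an arbitrary element α (universal property of ℤ[α]).
module Hooks {c ℓ : Level} (R : CommutativeRing c ℓ) where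
  open CommutativeRing R

  ι : ℕ → Carrier
  ι zero    = 0#
  ι (suc n) = 1# + ι n

  β : Carrier → Carrier
  β α = 1# - α

  h : UL → Carrier → (σ : Partition) → Cell σ → Carrier
  h U α σ x = ι (leg σ x) + (ι (arm σ x) + 1#) * α
  h L α σ x = (ι (leg σ x) + 1#) + ι (arm σ x) * α

  k : UL → UL → UL → Carrier → Carrier
  k L L L α = α
  k L L U α = - 1#
  k L U L α = 1# - (α + α)
  k L U U α = α
  k U U U α = - 1#
  k U U L α = α
  k U L U α = (1# + 1#) - α
  k U L L α = - 1#

  ΣUL : (UL → Carrier) → Carrier
  ΣUL f = f U + f L

  cube : Carrier → Carrier
  cube x = x * (x * x)

-- Since h^L = h^U + β, the left-hand side is the trilinear form with weights
-- k^{ĀB̄C̄} evaluated at (u, u + β), (v, v + β), (w, w + β), where u, v, w are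
-- the U-hooks of a, b, c.  Expanding in powers of β, the coefficient of uvw
-- (the sum of all eight k's) and those of uv, uw, vw (sums of four k's)
-- vanish; those of u, v, w are k^{LUU} + k^{UUU} = -β, k^{ULU} + k^{UUU} = β,
-- k^{UUL} + k^{UUU} = -β; and the constant term is k^{UUU} β³.
module Submission where

open import Defs
open import Level using (Level)
open import Algebra.Bundles using (CommutativeRing)
open import Algebra.Solver.Ring.AlmostCommutativeRing
  using (_-Raw-AlmostCommutative⟶_; fromCommutativeRing)
open import Data.Integer.Base as ℤ
  using (ℤ; +_; -[1+_]; +0; +[1+_]; sign; ∣_∣; _◃_; _⊖_)
import Data.Integer.Properties as ℤ using (_≟_; [1+m]⊖[1+n]≡m⊖n)
open import Data.Maybe.Base using (Maybe; map)
open import Data.Nat.Base as ℕ using (zero; suc)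
import Data.Nat.Properties as ℕ using (+-suc)
open import Data.Sign.Base as Sign using (Sign)
open import Relation.Binary.Consequences using (dec⇒weaklyDec)
import Relation.Binary.PropositionalEquality.Core as ≡

module IntegerCoefficientSolver {c ℓ : Level} (R : CommutativeRing c ℓ) where
  open CommutativeRing R
  open import Algebra.Properties.Semiring.Mult.TCOptimised semiring
    using (_×_; ×-homo-+; ×1-homo-*; 1+×)
  open import Algebra.Properties.Ring ring using (-1*x≈-x)
  open import Algebra.Properties.AbelianGroup +-abelianGroup using (⁻¹-∙-comm)
  open import Algebra.Properties.Group +-group using (⁻¹-involutive; ε⁻¹≈ε)
  open import Algebra.Properties.CommutativeSemigroup +-commutativeSemigroup
    using () renaming (interchange to +-interchange)
  open import Algebra.Properties.CommutativeSemigroup *-commutativeSemigroup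
    using () renaming (interchange to *-interchange)
  open import Relation.Binary.Reasoning.Setoid setoid

  -- The optimised _×_ makes ⟦ + 1 ⟧ and ⟦ + 2 ⟧ reduce to 1# and 1# + 1#, so
  -- solver output matches expressions written with 1# definitionally.
  ⟦_⟧ : ℤ → Carrier
  ⟦ + n      ⟧ = n × 1#
  ⟦ -[1+ n ] ⟧ = - (suc n × 1#)

  ⟦_⟧ˢ : Sign → Carrier
  ⟦ Sign.+ ⟧ˢ = 1#
  ⟦ Sign.- ⟧ˢ = - 1#

  ⟦⟧ˢ-homo-* : ∀ s t → ⟦ s Sign.* t ⟧ˢ ≈ ⟦ s ⟧ˢ * ⟦ t ⟧ˢ
  ⟦⟧ˢ-homo-* Sign.+ Sign.+ = sym (*-identityˡ 1#)
  ⟦⟧ˢ-homo-* Sign.+ Sign.- = sym (*-identityˡ (- 1#))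
  ⟦⟧ˢ-homo-* Sign.- Sign.+ = sym (*-identityʳ (- 1#))
  ⟦⟧ˢ-homo-* Sign.- Sign.- = sym (trans (-1*x≈-x (- 1#)) (⁻¹-involutive 1#))

  ⟦◃⟧ : ∀ s n → ⟦ s ◃ n ⟧ ≈ ⟦ s ⟧ˢ * (n × 1#)
  ⟦◃⟧ s      zero    = sym (zeroʳ ⟦ s ⟧ˢ)
  ⟦◃⟧ Sign.+ (suc n) = sym (*-identityˡ _)
  ⟦◃⟧ Sign.- (suc n) = sym (-1*x≈-x _)

  ⟦⟧≈sign*∣∣ : ∀ i → ⟦ i ⟧ ≈ ⟦ sign i ⟧ˢ * (∣ i ∣ × 1#)
  ⟦⟧≈sign*∣∣ (+ n)    = sym (*-identityˡ _)
  ⟦⟧≈sign*∣∣ -[1+ n ] = sym (-1*x≈-x _)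

  [z+x]-[z+y]≈x-y : ∀ z x y → (z + x) - (z + y) ≈ x - y
  [z+x]-[z+y]≈x-y z x y = begin
    (z + x) - (z + y)      ≈⟨ +-congˡ (⁻¹-∙-comm z y) ⟨
    (z + x) + (- z + - y)  ≈⟨ +-interchange z x (- z) (- y) ⟩
    (z - z) + (x - y)      ≈⟨ +-congʳ (-‿inverseʳ z) ⟩
    0# + (x - y)           ≈⟨ +-identityˡ (x - y) ⟩
    x - y                  ∎

  ⟦⊖⟧ : ∀ m n → ⟦ m ⊖ n ⟧ ≈ m × 1# - n × 1#
  ⟦⊖⟧ zero    zero    = sym (-‿inverseʳ 0#)
  ⟦⊖⟧ (suc m) zero    = sym (trans (+-congˡ ε⁻¹≈ε) (+-identityʳ _))
  ⟦⊖⟧ zero    (suc n) = sym (+-identityˡ _)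
  ⟦⊖⟧ (suc m) (suc n) = begin
    ⟦ suc m ⊖ suc n ⟧              ≡⟨ ≡.cong ⟦_⟧ (ℤ.[1+m]⊖[1+n]≡m⊖n m n) ⟩
    ⟦ m ⊖ n ⟧                      ≈⟨ ⟦⊖⟧ m n ⟩
    m × 1# - n × 1#                ≈⟨ [z+x]-[z+y]≈x-y 1# _ _ ⟨
    (1# + m × 1#) - (1# + n × 1#)  ≈⟨ +-cong (1+× m 1#) (-‿cong (1+× n 1#)) ⟨
    suc m × 1# - suc n × 1#        ∎

  ⟦⟧-homo-+ : ∀ i j → ⟦ i ℤ.+ j ⟧ ≈ ⟦ i ⟧ + ⟦ j ⟧
  ⟦⟧-homo-+ (+ m)    (+ n)    = ×-homo-+ 1# m n
  ⟦⟧-homo-+ (+ m)    -[1+ n ] = ⟦⊖⟧ m (suc n)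
  ⟦⟧-homo-+ -[1+ m ] (+ n)    = trans (⟦⊖⟧ n (suc m)) (+-comm _ _)
  ⟦⟧-homo-+ -[1+ m ] -[1+ n ] = begin
    - (suc (suc (m ℕ.+ n)) × 1#)     ≡⟨ ≡.cong (λ l → - (suc l × 1#)) (ℕ.+-suc m n) ⟨
    - ((suc m ℕ.+ suc n) × 1#)       ≈⟨ -‿cong (×-homo-+ 1# (suc m) (suc n)) ⟩
    - (suc m × 1# + suc n × 1#)      ≈⟨ ⁻¹-∙-comm _ _ ⟨
    - (suc m × 1#) + - (suc n × 1#)  ∎

  ⟦⟧-homo-* : ∀ i j → ⟦ i ℤ.* j ⟧ ≈ ⟦ i ⟧ * ⟦ j ⟧
  ⟦⟧-homo-* i j = begin
    ⟦ (sign i Sign.* sign j) ◃ (∣ i ∣ ℕ.* ∣ j ∣) ⟧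
      ≈⟨ ⟦◃⟧ (sign i Sign.* sign j) (∣ i ∣ ℕ.* ∣ j ∣) ⟩
    ⟦ sign i Sign.* sign j ⟧ˢ * ((∣ i ∣ ℕ.* ∣ j ∣) × 1#)
      ≈⟨ *-cong (⟦⟧ˢ-homo-* (sign i) (sign j)) (×1-homo-* ∣ i ∣ ∣ j ∣) ⟩
    (⟦ sign i ⟧ˢ * ⟦ sign j ⟧ˢ) * (∣ i ∣ × 1# * ∣ j ∣ × 1#)
      ≈⟨ *-interchange _ _ _ _ ⟩
    (⟦ sign i ⟧ˢ * ∣ i ∣ × 1#) * (⟦ sign j ⟧ˢ * ∣ j ∣ × 1#)
      ≈⟨ *-cong (⟦⟧≈sign*∣∣ i) (⟦⟧≈sign*∣∣ j) ⟨
    ⟦ i ⟧ * ⟦ j ⟧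
      ∎

  ⟦⟧-homo-‿ : ∀ i → ⟦ ℤ.- i ⟧ ≈ - ⟦ i ⟧
  ⟦⟧-homo-‿ +0       = sym ε⁻¹≈ε
  ⟦⟧-homo-‿ +[1+ n ] = refl
  ⟦⟧-homo-‿ -[1+ n ] = sym (⁻¹-involutive _)

  ℤ⟶R : ℤ.+-*-rawRing -Raw-AlmostCommutative⟶ fromCommutativeRing R
  ℤ⟶R = record
    { ⟦_⟧    = ⟦_⟧
    ; +-homo = ⟦⟧-homo-+
    ; *-homo = ⟦⟧-homo-*
    ; -‿homo = ⟦⟧-homo-‿
    ; 0-homo = refl
    ; 1-homo = refl
    }

  _≟⟦⟧_ : ∀ i j → Maybe (⟦ i ⟧ ≈ ⟦ j ⟧)
  i ≟⟦⟧ j = map (λ { ≡.refl → refl }) (dec⇒weaklyDec ℤ._≟_ i j)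

  open import Algebra.Solver.Ring ℤ.+-*-rawRing (fromCommutativeRing R) ℤ⟶R _≟⟦⟧_ public
    using (solve; _:=_; con; _:+_; _:*_; _:-_; :-_)

module HookForms {c ℓ : Level} (R : CommutativeRing c ℓ) where
  open CommutativeRing R
  open Hooks R
  open IntegerCoefficientSolver R

  kForm : Carrier → (UL → Carrier) → (UL → Carrier) → (UL → Carrier) → Carrier
  kForm α x y z = ΣUL λ A → ΣUL λ B → ΣUL λ C →
    ((x A * y B) * z C) * k (bar A) (bar B) (bar C) α

  kForm-cong : ∀ α {x x′ y y′ z z′} →
               (∀ A → x A ≈ x′ A) → (∀ B → y B ≈ y′ B) → (∀ C → z C ≈ z′ C) →
               kForm α x y z ≈ kForm α x′ y′ z′
  kForm-cong α x≈x′ y≈y′ z≈z′ = ΣUL-cong λ A → ΣUL-cong λ B → ΣUL-cong λ C →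
    *-congʳ {k (bar A) (bar B) (bar C) α} (*-cong (*-cong (x≈x′ A) (y≈y′ B)) (z≈z′ C))
    where
    ΣUL-cong : ∀ {f g} → (∀ A → f A ≈ g A) → ΣUL f ≈ ΣUL g
    ΣUL-cong f≈g = +-cong (f≈g U) (f≈g L)

  hookOf : UL → Carrier → Carrier → Carrier
  hookOf U α u = u
  hookOf L α u = u + β α

  h≈hookOf-hU : ∀ α σ x A → h A α σ x ≈ hookOf A α (h U α σ x)
  h≈hookOf-hU α σ x U = refl
  h≈hookOf-hU α σ x L = hL≈hU+β α (ι (leg σ x)) (ι (arm σ x))
    where
    hL≈hU+β : ∀ α l a → (l + 1#) + a * α ≈ (l + (a + 1#) * α) + (1# - α)
    hL≈hU+β = solve 3 (λ α l a →
      (l :+ one) :+ a :* α := (l :+ (a :+ one) :* α) :+ (one :- α)) refl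
      where one = con (+ 1)

  kForm-hookOf : ∀ α u v w →
    kForm α (λ A → hookOf A α u) (λ B → hookOf B α v) (λ C → hookOf C α w)
      ≈ (- ((u - v) + w) + k U U U α) * cube (β α)
  kForm-hookOf = solve 4 (λ α u v w →
    let one = con (+ 1)
        β = one :- α
        t x y z κ = ((x :* y) :* z) :* κ
        uL = u :+ β ; vL = v :+ β ; wL = w :+ β
    in   ((t u  v  w α           :+ t u  v  wL (:- one))
       :+ (t u  vL w (one :- (α :+ α)) :+ t u  vL wL α))
      :+ ((t uL v  w (:- one)    :+ t uL v  wL (con (+ 2) :- α))
       :+ (t uL vL w α           :+ t uL vL wL (:- one)))
     := (:- ((u :- v) :+ w) :+ :- one) :* (β :* (β :* β))) refl

mainTheorem4 : {c ℓ : Level} (R : CommutativeRing c ℓ) →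
  let open CommutativeRing R
      open Hooks R
  in (α : Carrier) (σ : Partition) (a b c : Cell σ) →
     ΣUL (λ A → ΣUL (λ B → ΣUL (λ C →
       ((h A α σ a * h B α σ b) * h C α σ c) * k (bar A) (bar B) (bar C) α)))
     ≈ (- ((h U α σ a - h U α σ b) + h U α σ c) + k U U U α) * cube (β α)
mainTheorem4 R α σ a b c = begin
  kForm α (λ A → h A α σ a) (λ B → h B α σ b) (λ C → h C α σ c)
    ≈⟨ kForm-cong α (h≈hookOf-hU α σ a) (h≈hookOf-hU α σ b) (h≈hookOf-hU α σ c) ⟩
  kForm α (λ A → hookOf A α (hU a)) (λ B → hookOf B α (hU b)) (λ C → hookOf C α (hU c))
    ≈⟨ kForm-hookOf α (hU a) (hU b) (hU c) ⟩
  (- ((hU a - hU b) + hU c) + k U U U α) * cube (β α)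
    ∎
  where
  open CommutativeRing R
  open Hooks R
  open HookForms R
  open import Relation.Binary.Reasoning.Setoid setoid

  hU : Cell σ → Carrier
  hU = h U α σ
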